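{- For all games $G,H,K$ over a poset $A$: (a) if $G\triangleright H$ and $H\le K$ then $G\triangleright K$; (b) if $G\le H$ and $H\triangleright K$ then $G\triangleright K$; (c) if $G\le H$ and $H\le K$ then $G\le K$.
   Context: Games over a poset $A$: for each $a\in A$, $[a]$ is an atomic game; if $L,R$ are non-empty sets of games, $\{L\mid R\}$ is a composite game with left options $L$ and right options $R$; atomic games have no options. Relations $\le,\triangleright$ by mutual recursion: $G\le H$ iff (1) every left option $G^L$ satisfies $G^L\triangleright H$, (2) every right option $H^R$ of $H$ satisfies $G\triangleright H^R$, (3) if $G$ or $H$ is atomic then $G\triangleright H$; $G\triangleright H$ iff (1) some right option $G^R$ of $G$ satisfies $G^R\le H$, or (2) some left option $H^L$ of $H$ satisfies $G\le H^L$, or (3) $G=[a],H=[b]$ are atomic and $a\le b$ in $A$. -}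

module Defs where

open import Level using (Level; _⊔_) renaming (suc to lsuc; zero to lzero)
open import Relation.Binary.Bundles using (Poset)
open import Data.Product using (Σ; _×_; _,_)
open import Data.Sum using (_⊎_)
open import Data.Empty using (⊥)
open import Data.Unit using (⊤)

module Games {c ℓ₁ ℓ₂ : Level} (A : Poset c ℓ₁ ℓ₂) where
  open Poset A using (Carrier) renaming (_≤_ to _≤ᴬ_)

  data Game : Set (lsuc lzero ⊔ c) where
    [_]  : Carrier → Game
    ⟨_∣_⟩ : {L R : Set} → (L → Game) → (R → Game) → L → R → Game
  -- (the last two explicit arguments witness non-emptiness of L and R)

  mutual
    _≤_ : Game → Game → Set ℓ₂
    [ a ] ≤ [ b ] = [ a ] ▷ [ b ]
    [ a ] ≤ (⟨_∣_⟩ {R = R} HL HR l r) =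
      ((j : R) → [ a ] ▷ HR j) × ([ a ] ▷ ⟨ HL ∣ HR ⟩ l r)
    (⟨_∣_⟩ {L = L} GL GR l r) ≤ [ b ] =
      ((i : L) → GL i ▷ [ b ]) × (⟨ GL ∣ GR ⟩ l r ▷ [ b ])
    (⟨_∣_⟩ {L = L} GL GR l r) ≤ (⟨_∣_⟩ {R = R} HL HR l' r') =
      ((i : L) → GL i ▷ ⟨ HL ∣ HR ⟩ l' r') × ((j : R) → ⟨ GL ∣ GR ⟩ l r ▷ HR j)

    _▷_ : Game → Game → Set ℓ₂
    [ a ] ▷ [ b ] = a ≤ᴬ b
    [ a ] ▷ (⟨_∣_⟩ {L = L} HL HR _ _) = Σ L λ j → [ a ] ≤ HL j
    (⟨_∣_⟩ {R = R} GL GR _ _) ▷ [ b ] = Σ R λ i → GR i ≤ [ b ]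
    (⟨_∣_⟩ {R = R} GL GR l r) ▷ (⟨_∣_⟩ {L = L} HL HR l' r') =
      (Σ R λ i → GR i ≤ ⟨ HL ∣ HR ⟩ l' r') ⊎ (Σ L λ j → ⟨ GL ∣ GR ⟩ l r ≤ HL j)

-- A proof of G ▷ H names a move (a right option of G, or a left
-- option of H) answered by a ≤, and a proof of G ≤ H answers every such move
-- with a ▷.  Chaining two relations thus reduces to chaining two relations in
-- which one of the three games is replaced by one of its options; at three
-- atoms, transitivity of A applies.
module Submission where

open import Defs
open import Level using (Level)
open import Relation.Binary.Bundles using (Poset)
open import Data.Product using (_×_; _,_)
open import Data.Sum using (inj₁; inj₂)

module GameOrder {c ℓ₁ ℓ₂ : Level} (A : Poset c ℓ₁ ℓ₂) where
  open Games A
  open Poset A using () renaming (trans to ≤ᴬ-trans)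

  mutual
    ▷-≤-trans : (G H K : Game) → G ▷ H → H ≤ K → G ▷ K
    ▷-≤-trans [ a ] [ b ] [ c ] a≤b b≤c = ≤ᴬ-trans a≤b b≤c
    ▷-≤-trans [ a ] [ b ] (⟨ KL ∣ _ ⟩ _ _) a≤b (_ , (k , b≤Kᴸ)) =
      k , ≤-trans [ a ] [ b ] (KL k) a≤b b≤Kᴸ
    ▷-≤-trans [ a ] (⟨ HL ∣ _ ⟩ _ _) [ c ] (j , a≤Hᴸ) (Hᴸ▷c , _) =
      ≤-▷-trans [ a ] (HL j) [ c ] a≤Hᴸ (Hᴸ▷c j)
    ▷-≤-trans [ a ] (⟨ HL ∣ _ ⟩ _ _) K@(⟨ _ ∣ _ ⟩ _ _) (j , a≤Hᴸ) (Hᴸ▷K , _) =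
      ≤-▷-trans [ a ] (HL j) K a≤Hᴸ (Hᴸ▷K j)
    ▷-≤-trans (⟨ _ ∣ GR ⟩ _ _) [ b ] [ c ] (i , Gᴿ≤b) b≤c =
      i , ≤-trans (GR i) [ b ] [ c ] Gᴿ≤b b≤c
    ▷-≤-trans (⟨ _ ∣ GR ⟩ _ _) [ b ] K@(⟨ _ ∣ _ ⟩ _ _) (i , Gᴿ≤b) b≤K =
      inj₁ (i , ≤-trans (GR i) [ b ] K Gᴿ≤b b≤K)
    ▷-≤-trans (⟨ _ ∣ GR ⟩ _ _) H@(⟨ _ ∣ _ ⟩ _ _) [ c ] (inj₁ (i , Gᴿ≤H)) H≤c =
      i , ≤-trans (GR i) H [ c ] Gᴿ≤H H≤c
    ▷-≤-trans G@(⟨ _ ∣ _ ⟩ _ _) (⟨ HL ∣ _ ⟩ _ _) [ c ] (inj₂ (j , G≤Hᴸ)) (Hᴸ▷c , _) =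
      ≤-▷-trans G (HL j) [ c ] G≤Hᴸ (Hᴸ▷c j)
    ▷-≤-trans (⟨ _ ∣ GR ⟩ _ _) H@(⟨ _ ∣ _ ⟩ _ _) K@(⟨ _ ∣ _ ⟩ _ _) (inj₁ (i , Gᴿ≤H)) H≤K =
      inj₁ (i , ≤-trans (GR i) H K Gᴿ≤H H≤K)
    ▷-≤-trans G@(⟨ _ ∣ _ ⟩ _ _) (⟨ HL ∣ _ ⟩ _ _) K@(⟨ _ ∣ _ ⟩ _ _) (inj₂ (j , G≤Hᴸ)) (Hᴸ▷K , _) =
      ≤-▷-trans G (HL j) K G≤Hᴸ (Hᴸ▷K j)

    ≤-▷-trans : (G H K : Game) → G ≤ H → H ▷ K → G ▷ K
    ≤-▷-trans [ a ] [ b ] [ c ] a≤b b≤c = ≤ᴬ-trans a≤b b≤c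
    ≤-▷-trans [ a ] [ b ] (⟨ KL ∣ _ ⟩ _ _) a≤b (k , b≤Kᴸ) =
      k , ≤-trans [ a ] [ b ] (KL k) a≤b b≤Kᴸ
    ≤-▷-trans [ a ] (⟨ _ ∣ HR ⟩ _ _) [ c ] (a▷Hᴿ , _) (j , Hᴿ≤c) =
      ▷-≤-trans [ a ] (HR j) [ c ] (a▷Hᴿ j) Hᴿ≤c
    ≤-▷-trans [ a ] (⟨ _ ∣ HR ⟩ _ _) K@(⟨ _ ∣ _ ⟩ _ _) (a▷Hᴿ , _) (inj₁ (j , Hᴿ≤K)) =
      ▷-≤-trans [ a ] (HR j) K (a▷Hᴿ j) Hᴿ≤K
    ≤-▷-trans [ a ] H@(⟨ _ ∣ _ ⟩ _ _) (⟨ KL ∣ _ ⟩ _ _) a≤H (inj₂ (k , H≤Kᴸ)) =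
      k , ≤-trans [ a ] H (KL k) a≤H H≤Kᴸ
    ≤-▷-trans (⟨ _ ∣ GR ⟩ _ _) [ b ] [ c ] (_ , (i , Gᴿ≤b)) b≤c =
      i , ≤-trans (GR i) [ b ] [ c ] Gᴿ≤b b≤c
    ≤-▷-trans G@(⟨ _ ∣ _ ⟩ _ _) [ b ] (⟨ KL ∣ _ ⟩ _ _) G≤b (k , b≤Kᴸ) =
      inj₂ (k , ≤-trans G [ b ] (KL k) G≤b b≤Kᴸ)
    ≤-▷-trans G@(⟨ _ ∣ _ ⟩ _ _) (⟨ _ ∣ HR ⟩ _ _) [ c ] (_ , G▷Hᴿ) (j , Hᴿ≤c) =
      ▷-≤-trans G (HR j) [ c ] (G▷Hᴿ j) Hᴿ≤c
    ≤-▷-trans G@(⟨ _ ∣ _ ⟩ _ _) (⟨ _ ∣ HR ⟩ _ _) K@(⟨ _ ∣ _ ⟩ _ _) (_ , G▷Hᴿ) (inj₁ (j , Hᴿ≤K)) =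
      ▷-≤-trans G (HR j) K (G▷Hᴿ j) Hᴿ≤K
    ≤-▷-trans G@(⟨ _ ∣ _ ⟩ _ _) H@(⟨ _ ∣ _ ⟩ _ _) (⟨ KL ∣ _ ⟩ _ _) G≤H (inj₂ (k , H≤Kᴸ)) =
      inj₂ (k , ≤-trans G H (KL k) G≤H H≤Kᴸ)

    -- When G or H is atomic, G ≤ H carries G ▷ H as a component, which is
    -- chained by the other two laws with unchanged G H K; this terminates
    -- because every recursive call made by those two laws shrinks a game.
    ≤-trans : (G H K : Game) → G ≤ H → H ≤ K → G ≤ K
    ≤-trans [ a ] [ b ] [ c ] a≤b b≤c = ≤ᴬ-trans a≤b b≤c
    ≤-trans [ a ] [ b ] K@(⟨ _ ∣ KR ⟩ _ _) a≤b (b▷Kᴿ , b▷K) =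
      (λ k → ≤-▷-trans [ a ] [ b ] (KR k) a≤b (b▷Kᴿ k)) ,
      ≤-▷-trans [ a ] [ b ] K a≤b b▷K
    ≤-trans [ a ] H@(⟨ _ ∣ _ ⟩ _ _) [ c ] (_ , a▷H) H≤c =
      ▷-≤-trans [ a ] H [ c ] a▷H H≤c
    ≤-trans [ a ] H@(⟨ _ ∣ _ ⟩ _ _) K@(⟨ _ ∣ KR ⟩ _ _) a≤H@(_ , a▷H) H≤K@(_ , H▷Kᴿ) =
      (λ k → ≤-▷-trans [ a ] H (KR k) a≤H (H▷Kᴿ k)) ,
      ▷-≤-trans [ a ] H K a▷H H≤K
    ≤-trans G@(⟨ GL ∣ _ ⟩ _ _) [ b ] [ c ] (Gᴸ▷b , G▷b) b≤c =
      (λ i → ▷-≤-trans (GL i) [ b ] [ c ] (Gᴸ▷b i) b≤c) ,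
      ▷-≤-trans G [ b ] [ c ] G▷b b≤c
    ≤-trans G@(⟨ GL ∣ _ ⟩ _ _) [ b ] K@(⟨ _ ∣ KR ⟩ _ _) G≤b@(Gᴸ▷b , _) b≤K@(b▷Kᴿ , _) =
      (λ i → ▷-≤-trans (GL i) [ b ] K (Gᴸ▷b i) b≤K) ,
      (λ k → ≤-▷-trans G [ b ] (KR k) G≤b (b▷Kᴿ k))
    ≤-trans G@(⟨ GL ∣ _ ⟩ _ _) H@(⟨ _ ∣ _ ⟩ _ _) [ c ] G≤H@(Gᴸ▷H , _) H≤c@(_ , H▷c) =
      (λ i → ▷-≤-trans (GL i) H [ c ] (Gᴸ▷H i) H≤c) ,
      ≤-▷-trans G H [ c ] G≤H H▷c
    ≤-trans G@(⟨ GL ∣ _ ⟩ _ _) H@(⟨ _ ∣ _ ⟩ _ _) K@(⟨ _ ∣ KR ⟩ _ _) G≤H@(Gᴸ▷H , _) H≤K@(_ , H▷Kᴿ) =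
      (λ i → ▷-≤-trans (GL i) H K (Gᴸ▷H i) H≤K) ,
      (λ k → ≤-▷-trans G H (KR k) G≤H (H▷Kᴿ k))

lemma4p6 : {c ℓ₁ ℓ₂ : Level} (A : Poset c ℓ₁ ℓ₂) →
    let open Games A in
    ((G H K : Game) → G ▷ H → H ≤ K → G ▷ K) ×
    ((G H K : Game) → G ≤ H → H ▷ K → G ▷ K) ×
    ((G H K : Game) → G ≤ H → H ≤ K → G ≤ K)
lemma4p6 A = ▷-≤-trans , ≤-▷-trans , ≤-trans
  where open GameOrder A
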